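{- Let $G$ be a finite simple graph with vertex set $I=\{\alpha_1,\dots,\alpha_n\}$, $\mathbf{k}\in\mathbb{Z}_+^n$, and let $p\in\mathcal{P}^i_{\mathbf{k}}(I,\zeta)$ with factorization $p=p_1\circ p_2\circ\cdots\circ p_{\mathbf{k}(i)}$ where each $p_j$ is an elementary pyramid with basis $\alpha_i$. Then every cyclic rotation $p_s\circ p_{s+1}\circ\cdots\circ p_{\mathbf{k}(i)}\circ p_1\circ\cdots\circ p_{s-1}$ ($1\le s\le\mathbf{k}(i)$) again lies in $\mathcal{P}^i_{\mathbf{k}}(I,\zeta)$.
   Context: Heaps over $G$: two vertices commute if distinct and non-adjacent; heaps are elements of the quotient of the free monoid on $I$ by the congruence generated by $ab=ba$ for commuting $a,b$, with product $\circ$ induced by concatenation. For a word $p_1\cdots p_r$ its pieces are partially ordered by the transitive closure of $p_s<p_t$ when $s<t$ and $p_s,p_t$ are equal or adjacent; this poset depends only on the heap. The weight of a heap counts its pieces in each position; $\mathbf{k}(i)$ is the $i$-th entry of $\mathbf{k}$. A pyramid is a heap with a unique minimal piece, whose position is its basis; $\mathcal{P}^i_{\mathbf{k}}(I,\zeta)$ is the set of pyramids of weight $\mathbf{k}$ with basis $\alpha_i$. A pyramid with basis $\alpha_i$ is elementary if its minimal piece is its only piece in position $\alpha_i$. (Known fact: the elementary pyramids with basis $\alpha_i$ freely generate a submonoid, and every pyramid in $\mathcal{P}^i_{\mathbf{k}}(I,\zeta)$ factors uniquely as a product of $\mathbf{k}(i)$ of them.) -}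

module Defs where

open import Level using (0ℓ)
open import Data.Nat using (ℕ; _<_; _≤_; _∸_)
open import Data.Fin using (Fin; toℕ)
open import Data.Fin.Properties using (_≟_)
open import Data.List using (List; []; _∷_; _++_; length; lookup; filter; concat; take; drop)
open import Data.Product using (Σ; ∃; _×_; _,_)
open import Data.Sum using (_⊎_)
open import Relation.Nullary using (¬_; Dec)
open import Relation.Binary.PropositionalEquality using (_≡_; _≢_)
open import Relation.Binary.Construct.Closure.Transitive using (TransClosure)
open import Relation.Binary.Construct.Closure.Equivalence using (EqClosure)

-- A finite simple graph on the vertex set Fin n (vertex α_{j+1} ↔ j : Fin n).
record SimpleGraph (n : ℕ) : Set₁ where
  field
    Adj    : Fin n → Fin n → Set
    sym    : ∀ {a b} → Adj a b → Adj b a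
    irrefl : ∀ {a} → ¬ Adj a a
    dec    : ∀ a b → Dec (Adj a b)

module Heaps {n : ℕ} (G : SimpleGraph n) where
  open SimpleGraph G

  Word : Set
  Word = List (Fin n)

  Commute : Fin n → Fin n → Set
  Commute a b = a ≢ b × ¬ Adj a b

  data SwapStep : Word → Word → Set where
    swap : ∀ u v a b → Commute a b → SwapStep (u ++ a ∷ b ∷ v) (u ++ b ∷ a ∷ v)

  -- equality of heaps: the congruence generated by ab = ba for commuting a, b
  _≈ₕ_ : Word → Word → Set
  _≈ₕ_ = EqClosure SwapStep

  Piece : Word → Set
  Piece w = Fin (length w)

  data Gen (w : Word) : Piece w → Piece w → Set where
    gen : ∀ s t → toℕ s < toℕ t →
          (lookup w s ≡ lookup w t ⊎ Adj (lookup w s) (lookup w t)) → Gen w s t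

  Below : (w : Word) → Piece w → Piece w → Set
  Below w = TransClosure (Gen w)

  Minimal : (w : Word) → Piece w → Set
  Minimal w t = ∀ s → ¬ Below w s t

  PyramidWithBasis : Fin n → Word → Set
  PyramidWithBasis i w =
    Σ (Piece w) λ m → Minimal w m × (∀ m' → Minimal w m' → m' ≡ m) × lookup w m ≡ i

  count : Fin n → Word → ℕ
  count j w = length (filter (λ x → x ≟ j) w)

  HasWeight : (Fin n → ℕ) → Word → Set
  HasWeight k w = ∀ j → count j w ≡ k j

  InP : Fin n → (Fin n → ℕ) → Word → Set
  InP i k w = PyramidWithBasis i w × HasWeight k w

  Elementary : Fin n → Word → Set
  Elementary i w = PyramidWithBasis i w × count i w ≡ 1

  -- rotation p_s ∘ … ∘ p_m ∘ p_1 ∘ … ∘ p_{s-1}  (s is 1-based)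
  rotate : ℕ → List Word → List Word
  rotate s ps = drop (s ∸ 1) ps ++ take (s ∸ 1) ps

module Submission where

-- The number of pieces in a given position is additive
--     under concatenation; hence it is invariant under commutation of
--     adjacent letters (so it is a function of the heap) and under any
--     rotation of a list of factors.  The rotated product therefore has
--     the weight of p₁ ∘ ⋯ ∘ pₘ ≈ p, namely k.
--
-- A word is a pyramid with basis αᵢ iff it is *rooted* at a
--     piece labelled i: that piece has no immediate predecessor and
--     every piece lies above it.  (Unique minimality gives rootedness by
--     induction on the position of a piece.)  Rooted words with the same
--     root label are closed under concatenation, since the root of the
--     left factor lies below the root of the right factor.  So the
--     product of any non-empty list of pyramids with basis αᵢ — in
--     particular every rotation of p₁, …, pₘ — is again such a pyramid.
--
-- Elementarity of the
-- factors is only used through "each pᵢ is a pyramid with basis αᵢ".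

open import Data.Nat using (ℕ; suc; _+_; _∸_; _<_; _≤_; _<?_; s≤s; z≤n)
open import Data.Nat.Properties
  using (+-comm; ≤-refl; ≤-trans; <-≤-trans; m≤m+n; +-monoʳ-<; m+n≮m; <⇒≤)
open import Data.Fin using (Fin; toℕ; zero; suc)
open import Data.Fin.Properties using (_≟_; any?; toℕ<n)
open import Data.List
  using (List; []; _∷_; _++_; length; concat; lookup; filter; take; drop)
open import Data.List.Properties
  using (filter-++; length-++; concat-++; take++drop≡id; ++-identityʳ)
open import Data.List.Relation.Unary.All using (All; []; _∷_)
import Data.List.Relation.Unary.All as All
open import Data.List.Relation.Unary.All.Properties using (++⁺; drop⁺; take⁺)
open import Data.Product using (∃; _,_; proj₁; proj₂)
open import Data.Sum using (_⊎_; inj₁; inj₂)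
open import Data.Empty using (⊥-elim)
open import Relation.Nullary using (¬_; Dec; yes; no)
open import Relation.Binary.PropositionalEquality
  using (_≡_; refl; sym; trans; cong; subst; subst₂; module ≡-Reasoning)
open import Relation.Binary.Construct.Closure.Transitive using ([_]; _∷_; _∷ʳ_)
open import Relation.Binary.Construct.Closure.ReflexiveTransitive using (ε; _◅_)
open import Relation.Binary.Construct.Closure.Symmetric using (fwd; bwd)

open import Defs

module Development {n : ℕ} (G : SimpleGraph n) where
  open SimpleGraph G using (Adj; dec)
  open Heaps G
  open ≡-Reasoning

  count-++ : ∀ j (xs ys : Word) → count j (xs ++ ys) ≡ count j xs + count j ys
  count-++ j xs ys =
    trans (cong length (filter-++ (_≟ j) xs ys)) (length-++ (filter (_≟ j) xs))

  count-transpose : ∀ j a b (v : Word) → count j (a ∷ b ∷ v) ≡ count j (b ∷ a ∷ v)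
  count-transpose j a b v = begin
    count j ((a ∷ b ∷ []) ++ v)            ≡⟨ count-++ j (a ∷ b ∷ []) v ⟩
    count j (a ∷ b ∷ []) + count j v       ≡⟨ cong (_+ count j v) swapped-pair ⟩
    count j (b ∷ a ∷ []) + count j v       ≡⟨ count-++ j (b ∷ a ∷ []) v ⟨
    count j ((b ∷ a ∷ []) ++ v)            ∎
    where
    swapped-pair : count j (a ∷ b ∷ []) ≡ count j (b ∷ a ∷ [])
    swapped-pair = trans (count-++ j (a ∷ []) (b ∷ []))
                   (trans (+-comm (count j (a ∷ [])) _) (sym (count-++ j (b ∷ []) (a ∷ []))))

  count-swapStep : ∀ j {x y} → SwapStep x y → count j x ≡ count j y
  count-swapStep j (swap u v a b _) = begin
    count j (u ++ a ∷ b ∷ v)            ≡⟨ count-++ j u (a ∷ b ∷ v) ⟩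
    count j u + count j (a ∷ b ∷ v)     ≡⟨ cong (count j u +_) (count-transpose j a b v) ⟩
    count j u + count j (b ∷ a ∷ v)     ≡⟨ count-++ j u (b ∷ a ∷ v) ⟨
    count j (u ++ b ∷ a ∷ v)            ∎

  count-≈ₕ : ∀ j {x y} → x ≈ₕ y → count j x ≡ count j y
  count-≈ₕ j ε            = refl
  count-≈ₕ j (fwd s ◅ ss) = trans (count-swapStep j s) (count-≈ₕ j ss)
  count-≈ₕ j (bwd s ◅ ss) = trans (sym (count-swapStep j s)) (count-≈ₕ j ss)

  count-rotate : ∀ j m (ps : List Word) →
                 count j (concat (drop m ps ++ take m ps)) ≡ count j (concat ps)
  count-rotate j m ps = begin
    count j (concat (drop m ps ++ take m ps))     ≡⟨ cong (count j) (concat-++ (drop m ps) (take m ps)) ⟨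
    count j (concat (drop m ps) ++ concat (take m ps))
                                                  ≡⟨ count-++ j (concat (drop m ps)) (concat (take m ps)) ⟩
    count j (concat (drop m ps)) + count j (concat (take m ps))
                                                  ≡⟨ +-comm (count j (concat (drop m ps))) _ ⟩
    count j (concat (take m ps)) + count j (concat (drop m ps))
                                                  ≡⟨ count-++ j (concat (take m ps)) (concat (drop m ps)) ⟨
    count j (concat (take m ps) ++ concat (drop m ps))
                                                  ≡⟨ cong (count j) (concat-++ (take m ps) (drop m ps)) ⟩
    count j (concat (take m ps ++ drop m ps))     ≡⟨ cong (λ qs → count j (concat qs)) (take++drop≡id m ps) ⟩
    count j (concat ps)                           ∎

  length-rotate : ∀ {A : Set} m (xs : List A) → length (drop m xs ++ take m xs) ≡ length xs
  length-rotate m xs = begin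
    length (drop m xs ++ take m xs)        ≡⟨ length-++ (drop m xs) ⟩
    length (drop m xs) + length (take m xs) ≡⟨ +-comm (length (drop m xs)) _ ⟩
    length (take m xs) + length (drop m xs) ≡⟨ length-++ (take m xs) ⟨
    length (take m xs ++ drop m xs)        ≡⟨ cong length (take++drop≡id m xs) ⟩
    length xs                              ∎

  record Rooted (i : Fin n) (w : Word) : Set where
    field
      root         : Piece w
      root-label   : lookup w root ≡ i
      root-initial : ∀ s → ¬ Gen w s root
      root-below   : ∀ t → t ≡ root ⊎ Below w root t

  last-step : ∀ {w s t} → Below w s t → ∃ λ r → Gen w r t
  last-step [ g ]    = _ , g
  last-step (_ ∷ gs) = last-step gs

  -- The generating relation is decidable, so "t has an immediate
  -- predecessor" can be decided piece by piece.
  gen? : ∀ w s t → Dec (Gen w s t)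
  gen? w s t with toℕ s <? toℕ t
  ... | no s≮t = no λ { (gen _ _ s<t _) → s≮t s<t }
  ... | yes s<t with lookup w s ≟ lookup w t
  ...   | yes same = yes (gen s t s<t (inj₁ same))
  ...   | no differ with dec (lookup w s) (lookup w t)
  ...     | yes adj = yes (gen s t s<t (inj₂ adj))
  ...     | no ¬adj = no λ { (gen _ _ _ (inj₁ same)) → differ same
                           ; (gen _ _ _ (inj₂ adj))  → ¬adj adj }

  -- If m is the only minimal piece, every piece is m or above m:
  -- a non-minimal piece has an immediate predecessor at a smaller
  -- position, to which the claim applies by induction on the position.
  above-unique-minimal : ∀ w m → (∀ m' → Minimal w m' → m' ≡ m) →
                         ∀ N t → toℕ t < N → t ≡ m ⊎ Below w m t
  above-unique-minimal w m unique (suc N) t (s≤s t≤N)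
    with any? (λ s → gen? w s t)
  ... | no no-pred = inj₁ (unique t λ s s<t → no-pred (last-step s<t))
  ... | yes (s , s⋖t@(gen _ _ s<t _))
    with above-unique-minimal w m unique N s (<-≤-trans s<t t≤N)
  ...   | inj₁ refl = inj₂ [ s⋖t ]
  ...   | inj₂ m<s  = inj₂ (m<s ∷ʳ s⋖t)

  pyramid⇒rooted : ∀ i w → PyramidWithBasis i w → Rooted i w
  pyramid⇒rooted i w (m , minimal , unique , label) = record
    { root         = m
    ; root-label   = label
    ; root-initial = λ s s⋖m → minimal s [ s⋖m ]
    ; root-below   = λ t → above-unique-minimal w m unique (suc (toℕ t)) t ≤-refl
    }

  rooted⇒pyramid : ∀ i w → Rooted i w → PyramidWithBasis i w
  rooted⇒pyramid i w r =
    root , minimal , unique , root-label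
    where
    open Rooted r
    minimal : Minimal w root
    minimal s s<root = root-initial _ (proj₂ (last-step s<root))
    unique : ∀ m' → Minimal w m' → m' ≡ root
    unique m' minimal' with root-below m'
    ... | inj₁ m'≡root  = m'≡root
    ... | inj₂ root<m' = ⊥-elim (minimal' root root<m')


  injˡ : ∀ (u v : Word) → Piece u → Piece (u ++ v)
  injˡ (x ∷ u) v zero    = zero
  injˡ (x ∷ u) v (suc a) = suc (injˡ u v a)

  injʳ : ∀ (u v : Word) → Piece v → Piece (u ++ v)
  injʳ []      v b = b
  injʳ (x ∷ u) v b = suc (injʳ u v b)

  lookup-injˡ : ∀ u v a → lookup (u ++ v) (injˡ u v a) ≡ lookup u a
  lookup-injˡ (x ∷ u) v zero    = refl
  lookup-injˡ (x ∷ u) v (suc a) = lookup-injˡ u v a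

  lookup-injʳ : ∀ u v b → lookup (u ++ v) (injʳ u v b) ≡ lookup v b
  lookup-injʳ []      v b = refl
  lookup-injʳ (x ∷ u) v b = lookup-injʳ u v b

  toℕ-injˡ : ∀ u v a → toℕ (injˡ u v a) ≡ toℕ a
  toℕ-injˡ (x ∷ u) v zero    = refl
  toℕ-injˡ (x ∷ u) v (suc a) = cong suc (toℕ-injˡ u v a)

  toℕ-injʳ : ∀ u v b → toℕ (injʳ u v b) ≡ length u + toℕ b
  toℕ-injʳ []      v b = refl
  toℕ-injʳ (x ∷ u) v b = cong suc (toℕ-injʳ u v b)

  piece-++ : ∀ u v (t : Piece (u ++ v)) →
             (∃ λ a → t ≡ injˡ u v a) ⊎ (∃ λ b → t ≡ injʳ u v b)
  piece-++ []      v t       = inj₂ (t , refl)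
  piece-++ (x ∷ u) v zero    = inj₁ (zero , refl)
  piece-++ (x ∷ u) v (suc t) with piece-++ u v t
  ... | inj₁ (a , t≡a) = inj₁ (suc a , cong suc t≡a)
  ... | inj₂ (b , t≡b) = inj₂ (b , cong suc t≡b)

  gen-transfer : ∀ {w w′} {s t : Piece w} {s′ t′ : Piece w′} →
                 (toℕ s < toℕ t → toℕ s′ < toℕ t′) →
                 lookup w s ≡ lookup w′ s′ → lookup w t ≡ lookup w′ t′ →
                 Gen w s t → Gen w′ s′ t′
  gen-transfer order ls lt (gen _ _ s<t (inj₁ same)) =
    gen _ _ (order s<t) (inj₁ (trans (sym ls) (trans same lt)))
  gen-transfer order ls lt (gen _ _ s<t (inj₂ adj)) =
    gen _ _ (order s<t) (inj₂ (subst₂ Adj ls lt adj))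

  gen-injˡ : ∀ u v {a b} → Gen u a b → Gen (u ++ v) (injˡ u v a) (injˡ u v b)
  gen-injˡ u v {a} {b} =
    gen-transfer (subst₂ _<_ (sym (toℕ-injˡ u v a)) (sym (toℕ-injˡ u v b)))
                 (sym (lookup-injˡ u v a)) (sym (lookup-injˡ u v b))

  gen-injʳ : ∀ u v {a b} → Gen v a b → Gen (u ++ v) (injʳ u v a) (injʳ u v b)
  gen-injʳ u v {a} {b} =
    gen-transfer (λ a<b → subst₂ _<_ (sym (toℕ-injʳ u v a)) (sym (toℕ-injʳ u v b))
                                     (+-monoʳ-< (length u) a<b))
                 (sym (lookup-injʳ u v a)) (sym (lookup-injʳ u v b))

  below-injˡ : ∀ u v {a b} → Below u a b → Below (u ++ v) (injˡ u v a) (injˡ u v b)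
  below-injˡ u v [ g ]    = [ gen-injˡ u v g ]
  below-injˡ u v (g ∷ gs) = gen-injˡ u v g ∷ below-injˡ u v gs

  below-injʳ : ∀ u v {a b} → Below v a b → Below (u ++ v) (injʳ u v a) (injʳ u v b)
  below-injʳ u v [ g ]    = [ gen-injʳ u v g ]
  below-injʳ u v (g ∷ gs) = gen-injʳ u v g ∷ below-injʳ u v gs

  -- An immediate predecessor of a piece of u is itself a piece of u,
  -- since the pieces of v come later.
  gen-into-injˡ : ∀ u v s b → Gen (u ++ v) s (injˡ u v b) → ∃ λ a → Gen u a b
  gen-into-injˡ u v s b s⋖b with piece-++ u v s
  ... | inj₁ (a , refl) =
    a , gen-transfer (subst₂ _<_ (toℕ-injˡ u v a) (toℕ-injˡ u v b))
                     (lookup-injˡ u v a) (lookup-injˡ u v b) s⋖b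
  ... | inj₂ (c , refl) with s⋖b
  ...   | gen _ _ c<b _ =
    ⊥-elim (m+n≮m (length u) (toℕ c)
      (<-≤-trans (subst₂ _<_ (toℕ-injʳ u v c) (toℕ-injˡ u v b) c<b) (<⇒≤ (toℕ<n b))))

  -- Rooted words with the same root label are closed under product: the
  -- root of u stays initial, and lies directly below the root of v
  -- (same label, earlier position), hence below every piece of v.
  rooted-++ : ∀ i u v → Rooted i u → Rooted i v → Rooted i (u ++ v)
  rooted-++ i u v ru rv = record
    { root         = injˡ u v (root ru)
    ; root-label   = trans (lookup-injˡ u v (root ru)) (root-label ru)
    ; root-initial = initial
    ; root-below   = below
    }
    where
    open Rooted

    initial : ∀ s → ¬ Gen (u ++ v) s (injˡ u v (root ru))
    initial s s⋖root = root-initial ru _ (proj₂ (gen-into-injˡ u v s (root ru) s⋖root))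

    roots-linked : Gen (u ++ v) (injˡ u v (root ru)) (injʳ u v (root rv))
    roots-linked = gen _ _
      (subst₂ _<_ (sym (toℕ-injˡ u v (root ru))) (sym (toℕ-injʳ u v (root rv)))
              (<-≤-trans (toℕ<n (root ru)) (m≤m+n (length u) (toℕ (root rv)))))
      (inj₁ (trans (lookup-injˡ u v (root ru))
            (trans (root-label ru) (sym (trans (lookup-injʳ u v (root rv)) (root-label rv))))))

    below : ∀ t → t ≡ injˡ u v (root ru) ⊎ Below (u ++ v) (injˡ u v (root ru)) t
    below t with piece-++ u v t
    ... | inj₁ (a , refl) with root-below ru a
    ...   | inj₁ refl    = inj₁ refl
    ...   | inj₂ root<a  = inj₂ (below-injˡ u v root<a)
    below t | inj₂ (b , refl) with root-below rv b
    ...   | inj₁ refl    = inj₂ [ roots-linked ]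
    ...   | inj₂ root<b  = inj₂ (roots-linked ∷ below-injʳ u v root<b)

  rooted-concat : ∀ i (qs : List Word) → All (Rooted i) qs → 1 ≤ length qs →
                  Rooted i (concat qs)
  rooted-concat i (q ∷ [])      (rq ∷ [])  _ = subst (Rooted i) (sym (++-identityʳ q)) rq
  rooted-concat i (q ∷ q′ ∷ qs) (rq ∷ rqs) _ =
    rooted-++ i q (concat (q′ ∷ qs)) rq (rooted-concat i (q′ ∷ qs) rqs (s≤s z≤n))

lemma2p10 : ∀ {n : ℕ} (G : SimpleGraph n) (k : Fin n → ℕ) (i : Fin n)
    (p : Heaps.Word G) (ps : List (Heaps.Word G)) →
    Heaps.InP G i k p →
    length ps ≡ k i →
    All (Heaps.Elementary G i) ps →
    Heaps._≈ₕ_ G p (concat ps) →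
    ∀ (s : ℕ) → 1 ≤ s → s ≤ k i →
    Heaps.InP G i k (concat (Heaps.rotate G s ps))
lemma2p10 G k i p ps (_ , weight-p) len elementary p≈ps s 1≤s s≤ki =
  rooted⇒pyramid i _ (rooted-concat i rotated rooted-factors nonempty) , weight
  where
  open Heaps G
  open Development G
  m = s ∸ 1
  rotated = drop m ps ++ take m ps

  rooted-factors : All (Rooted i) rotated
  rooted-factors = ++⁺ (drop⁺ m rooted) (take⁺ m rooted)
    where rooted = All.map (λ e → pyramid⇒rooted i _ (proj₁ e)) elementary

  nonempty : 1 ≤ length rotated
  nonempty = subst (1 ≤_) (sym (trans (length-rotate m ps) len)) (≤-trans 1≤s s≤ki)

  weight : HasWeight k (concat rotated)
  weight j = trans (count-rotate j m ps) (trans (sym (count-≈ₕ j p≈ps)) (weight-p j))
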